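{- For $n \geq 2$, let $P_n$ be the path with $n$ edges (and $n+1$ vertices). Then ${\rm ML}^{\rm W}(P_n)=0$ if $n=2$; ${\rm ML}^{\rm W}(P_n)=1$ if $n=3$; ${\rm ML}^{\rm W}(P_n)=2$ if $n\in\{4,5\}$; and ${\rm ML}^{\rm W}(P_n)=2n-10$ if $n\geq 6$.
   Context: A walk of a graph $G$ is a sequence of vertices in which consecutive vertices are adjacent (repetitions allowed); its length is its number of traversed edges with repetition (a single vertex is a walk of length $0$). For a walk $W$, $G+W$ is the multigraph on $V(G)$ with edge multiset $E(G)$ plus every edge traversed by $W$, added as many times as traversed. A multigraph is locally irregular if no two adjacent vertices have the same degree; $W$ is irregularising if $G+W$ is locally irregular. ${\rm ML}^{\rm W}(G)$ is the minimum length of an irregularising walk of $G$, $+\infty$ if none exists. -}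

module Defs where

open import Data.Nat using (ℕ; zero; suc; _+_; _≤_)
open import Data.Fin using (Fin; toℕ)
open import Data.Fin.Properties using (_≟_)
open import Data.List using (List; []; _∷_; length; map)
open import Data.Nat.ListAction using (sum)
open import Data.List.Base using (allFin)
open import Data.Product using (Σ; _×_; _,_)
open import Relation.Nullary using (¬_; Dec; yes; no)
open import Relation.Binary.PropositionalEquality using (_≡_; refl)
import Data.Nat.Properties as ℕP
open import Data.Sum using (_⊎_; inj₁; inj₂)

record Graph : Set₁ where
  field
    size  : ℕ
    Adj   : Fin size → Fin size → Set
    adj?  : (u v : Fin size) → Dec (Adj u v)
    sym   : ∀ {u v} → Adj u v → Adj v u
    irrefl : ∀ {u} → ¬ Adj u u

open Graph public

⌊_⌋ℕ : {P : Set} → Dec P → ℕ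
⌊ yes _ ⌋ℕ = 1
⌊ no  _ ⌋ℕ = 0

deg : (G : Graph) → Fin (size G) → ℕ
deg G v = sum (map (λ u → ⌊ adj? G v u ⌋ℕ) (allFin (size G)))

data IsWalk (G : Graph) : List (Fin (size G)) → Set where
  single : ∀ v → IsWalk G (v ∷ [])
  step   : ∀ {u v vs} → Adj G u v → IsWalk G (v ∷ vs) → IsWalk G (u ∷ v ∷ vs)

walkLength : {A : Set} → List A → ℕ
walkLength []       = 0
walkLength (_ ∷ []) = 0
walkLength (_ ∷ v ∷ vs) = suc (walkLength (v ∷ vs))

-- number of times the walk traverses an edge incident with x
-- (each traversal of edge ab adds 1 to the degrees of a and of b)
extra : {k : ℕ} → Fin k → List (Fin k) → ℕ
extra x []       = 0
extra x (_ ∷ []) = 0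
extra x (a ∷ b ∷ vs) = ⌊ a ≟ x ⌋ℕ + ⌊ b ≟ x ⌋ℕ + extra x (b ∷ vs)

degPlus : (G : Graph) → List (Fin (size G)) → Fin (size G) → ℕ
degPlus G W x = deg G x + extra x W

-- G + W is locally irregular: adjacent vertices have distinct degrees.
-- (The edges added by W are edges of G, so adjacency in G + W is
-- adjacency in G.)
Irregularising : (G : Graph) → List (Fin (size G)) → Set
Irregularising G W =
  IsWalk G W × (∀ u v → Adj G u v → ¬ (degPlus G W u ≡ degPlus G W v))

MLW≡ : Graph → ℕ → Set
MLW≡ G m =
  Σ (List (Fin (size G))) (λ W → Irregularising G W × walkLength W ≡ m)
  × (∀ W → Irregularising G W → m ≤ walkLength W)

data PathAdj {k : ℕ} (i j : Fin k) : Set where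
  fwd : suc (toℕ i) ≡ toℕ j → PathAdj i j
  bwd : suc (toℕ j) ≡ toℕ i → PathAdj i j

pathAdj? : {k : ℕ} (i j : Fin k) → Dec (PathAdj i j)
pathAdj? i j with suc (toℕ i) ℕP.≟ toℕ j | suc (toℕ j) ℕP.≟ toℕ i
... | yes p | _     = yes (fwd p)
... | no _  | yes q = yes (bwd q)
... | no ¬p | no ¬q = no λ { (fwd p) → ¬p p ; (bwd q) → ¬q q }

pathAdj-sym : {k : ℕ} {i j : Fin k} → PathAdj i j → PathAdj j i
pathAdj-sym (fwd p) = bwd p
pathAdj-sym (bwd q) = fwd q

pathAdj-irrefl : {k : ℕ} {i : Fin k} → ¬ PathAdj i i
pathAdj-irrefl (fwd p) = ℕP.1+n≢n p
pathAdj-irrefl (bwd p) = ℕP.1+n≢n p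

P : ℕ → Graph
P n = record
  { size = suc n ; Adj = PathAdj ; adj? = pathAdj?
  ; sym = pathAdj-sym ; irrefl = pathAdj-irrefl }

{-# OPTIONS --safe #-}
-- Write c j for the number of times a walk W in P n crosses the edge {j, j + 1}.  In P n + W an
-- inner vertex j + 1 has degree 2 + c j + c (j + 1), and an end vertex always has smaller degree
-- than its neighbour, so W is irregularising iff c j ≢ c (j + 2) whenever j + 2 < n.  If W runs
-- between a ≤ c, then c j is odd exactly when a ≤ j < c.  Outside that range c j is even, and it
-- is nonzero except on the two outermost edges at either end: a zero count confines W to one side
-- of edge j, which forces a second zero two edges further out.  Odd counts two apart differ, so
-- at most one of them is 1.  Hence the length Σ c j is at least
-- (2a − 4) + (2(c − a) − 2) + (2(n − c) − 4) = 2n − 10.  For n ≥ 6 the bound is attained by the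
-- count patterns 0 0 (1 1 3 3)ᵏ 1 1 0 0,  0 0 (1 1 3 3)ᵏ 1 1 2 0 0,  0 0 (1 1 3 3)ᵏ 1 1 2 2 0 0
-- and 0 0 2 2 (1 1 3 3)ᵏ 1 1 2 0 0, one for each residue of n mod 4.

module Submission where

open import Defs hiding (sym)
open import Data.Nat using (ℕ; zero; suc; _+_; _*_; _∸_; _⊓_; _≤_; _<_; _≤?_; _<?_; z≤n; s≤s; s≤s⁻¹; z<s; parity)
open import Data.Nat.Properties
open import Data.Nat.DivMod using (_%_; _/_; m≡m%n+[m/n]*n; m%n<n)
open import Data.Nat.ListAction using (sum)
open import Data.Nat.Tactic.RingSolver using (solve-∀)
open import Data.Parity.Base as ℙ using (Parity; 0ℙ; 1ℙ)
open import Data.Parity.Properties using (+-homo-+; +-inverse; ⁻¹-involutive) renaming (+-comm to ℙ-+-comm)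
open import Data.Fin using (Fin; toℕ; fromℕ<)
open import Data.Fin.Properties using (toℕ≤pred[n]; toℕ-fromℕ<; toℕ-injective)
import Data.Fin.Properties as Fin
open import Data.List using (List; []; _∷_; _++_; _∷ʳ_; map; applyUpTo; length; tabulate; allFin)
open import Data.List.Properties using (map-tabulate; tabulate-cong)
open import Data.List.Relation.Unary.All as All using (All; []; _∷_)
import Data.List.Relation.Unary.All.Properties as All
open import Data.Product using (Σ; ∃; _×_; _,_; proj₁; proj₂)
open import Data.Sum using (inj₁; inj₂)
open import Function using (id; _∘_; _⇔_; mk⇔; Equivalence)
open import Relation.Nullary using (¬_; Dec; yes; no; contradiction)
open import Relation.Nullary.Decidable using (True; toWitness; map′; ¬?; _×-dec_)
open import Relation.Binary.PropositionalEquality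
open import Relation.Binary.Definitions using (tri<; tri≈; tri>)
open import Algebra.Properties.CommutativeSemigroup +-commutativeSemigroup using (interchange; x∙yz≈y∙xz)

⌊⌋ℕ≡1 : {P : Set} (p : Dec P) → P → ⌊ p ⌋ℕ ≡ 1
⌊⌋ℕ≡1 (yes _) _  = refl
⌊⌋ℕ≡1 (no ¬p) p = contradiction p ¬p

⌊⌋ℕ≡0 : {P : Set} (p : Dec P) → ¬ P → ⌊ p ⌋ℕ ≡ 0
⌊⌋ℕ≡0 (yes p) ¬p = contradiction p ¬p
⌊⌋ℕ≡0 (no _)  _  = refl

⌊⌋ℕ≡0⇒¬ : {P : Set} (p : Dec P) → ⌊ p ⌋ℕ ≡ 0 → ¬ P
⌊⌋ℕ≡0⇒¬ (no ¬p) _ = ¬p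

⌊⌋ℕ-cong : {P Q : Set} → (P → Q) → (Q → P) → (p : Dec P) (q : Dec Q) → ⌊ p ⌋ℕ ≡ ⌊ q ⌋ℕ
⌊⌋ℕ-cong P→Q Q→P (yes p) q = sym (⌊⌋ℕ≡1 q (P→Q p))
⌊⌋ℕ-cong P→Q Q→P (no ¬p) q = sym (⌊⌋ℕ≡0 q (¬p ∘ Q→P))

⌊⌋ℕ≤1 : {P : Set} (p : Dec P) → ⌊ p ⌋ℕ ≤ 1
⌊⌋ℕ≤1 (yes _) = ≤-refl
⌊⌋ℕ≤1 (no _)  = z≤n

sum-applyUpTo-split : ∀ (f : ℕ → ℕ) m k →
  sum (applyUpTo f (m + k)) ≡ sum (applyUpTo f m) + sum (applyUpTo (λ i → f (m + i)) k)
sum-applyUpTo-split f zero    k = refl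
sum-applyUpTo-split f (suc m) k =
  trans (cong (f 0 +_) (sum-applyUpTo-split (f ∘ suc) m k)) (sym (+-assoc (f 0) _ _))

sum-applyUpTo-distrib : ∀ (f g : ℕ → ℕ) m →
  sum (applyUpTo (λ i → f i + g i) m) ≡ sum (applyUpTo f m) + sum (applyUpTo g m)
sum-applyUpTo-distrib f g zero    = refl
sum-applyUpTo-distrib f g (suc m) =
  trans (cong (f 0 + g 0 +_) (sum-applyUpTo-distrib (f ∘ suc) (g ∘ suc) m)) (interchange (f 0) (g 0) _ _)

sum-applyUpTo-cong : ∀ {f g : ℕ → ℕ} m → (∀ i → f i ≡ g i) → sum (applyUpTo f m) ≡ sum (applyUpTo g m)
sum-applyUpTo-cong zero    eq = refl
sum-applyUpTo-cong (suc m) eq = cong₂ _+_ (eq 0) (sum-applyUpTo-cong m (eq ∘ suc))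

sum-applyUpTo-zero : ∀ m → sum (applyUpTo (λ _ → 0) m) ≡ 0
sum-applyUpTo-zero zero    = refl
sum-applyUpTo-zero (suc m) = sum-applyUpTo-zero m

sum-applyUpTo-≟ : ∀ c m → sum (applyUpTo (λ j → ⌊ c ≟ j ⌋ℕ) m) ≡ ⌊ c <? m ⌋ℕ
sum-applyUpTo-≟ c       zero    = sym (⌊⌋ℕ≡0 (c <? 0) λ ())
sum-applyUpTo-≟ zero    (suc m) = cong suc (sum-applyUpTo-zero m)
sum-applyUpTo-≟ (suc c) (suc m) = begin
  sum (applyUpTo (λ j → ⌊ suc c ≟ suc j ⌋ℕ) m)
    ≡⟨ sum-applyUpTo-cong m (λ j → ⌊⌋ℕ-cong suc-injective (cong suc) (suc c ≟ suc j) (c ≟ j)) ⟩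
  sum (applyUpTo (λ j → ⌊ c ≟ j ⌋ℕ) m)
    ≡⟨ sum-applyUpTo-≟ c m ⟩
  ⌊ c <? m ⌋ℕ
    ≡⟨ ⌊⌋ℕ-cong s≤s s≤s⁻¹ (c <? m) (suc c <? suc m) ⟩
  ⌊ suc c <? suc m ⌋ℕ
    ∎
  where open ≡-Reasoning

m*k≤sum-applyUpTo : ∀ {k} m (f : ℕ → ℕ) → (∀ i → i < m → k ≤ f i) → m * k ≤ sum (applyUpTo f m)
m*k≤sum-applyUpTo zero    f k≤f = z≤n
m*k≤sum-applyUpTo (suc m) f k≤f =
  +-mono-≤ (k≤f 0 z<s) (m*k≤sum-applyUpTo m (f ∘ suc) (λ i i<m → k≤f (suc i) (s≤s i<m)))

DistinctTwoApart : ℕ → (ℕ → ℕ) → Set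
DistinctTwoApart n f = ∀ j → 2 + j < n → f j ≢ f (2 + j)

distinctTwoApart-suc : ∀ m f → DistinctTwoApart (3 + m) f ⇔ (f 0 ≢ f 2 × DistinctTwoApart (2 + m) (f ∘ suc))
distinctTwoApart-suc m f = mk⇔
  (λ d → d 0 (s≤s (s≤s (s≤s z≤n))) , λ j lt → d (suc j) (s≤s lt))
  (λ { (f0≢f2 , d) zero _ → f0≢f2 ; (f0≢f2 , d) (suc j) lt → d j (s≤s⁻¹ lt) })

distinctTwoApart? : ∀ n f → Dec (DistinctTwoApart n f)
distinctTwoApart? 0 f = yes λ { _ () }
distinctTwoApart? 1 f = yes λ { _ (s≤s ()) }
distinctTwoApart? 2 f = yes λ { _ (s≤s (s≤s ())) }
distinctTwoApart? (suc (suc (suc m))) f =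
  map′ (Equivalence.from (distinctTwoApart-suc m f)) (Equivalence.to (distinctTwoApart-suc m f))
    (¬? (f 0 ≟ f 2) ×-dec distinctTwoApart? (suc (suc m)) (f ∘ suc))

distinctTwoApart-drop : ∀ l {m} {f : ℕ → ℕ} →
  DistinctTwoApart (l + m) f → DistinctTwoApart m (λ i → f (l + i))
distinctTwoApart-drop zero    d = d
distinctTwoApart-drop (suc l) d = distinctTwoApart-drop l (λ j lt → d (suc j) (s≤s lt))

distinctTwoApart-glue : ∀ s {m} {f g : ℕ → ℕ} → DistinctTwoApart (2 + s) g → (∀ i → g (s + i) ≡ f i) →
  DistinctTwoApart m f → DistinctTwoApart (s + m) g
distinctTwoApart-glue zero    _ g≡f d j lt e = d j lt (trans (sym (g≡f j)) (trans e (g≡f (2 + j))))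
distinctTwoApart-glue (suc s) start g≡f d zero    _  = start 0 (s≤s (s≤s (s≤s z≤n)))
distinctTwoApart-glue (suc s) start g≡f d (suc j) lt =
  distinctTwoApart-glue s (λ j lt → start (suc j) (s≤s lt)) g≡f d j (s≤s⁻¹ lt)

≥2-but-first-two⇒sum-bound : ∀ m (f : ℕ → ℕ) → (∀ i → 2 ≤ i → i < m → 2 ≤ f i) →
  m * 2 ≤ 4 + sum (applyUpTo f m)
≥2-but-first-two⇒sum-bound 0 f _ = z≤n
≥2-but-first-two⇒sum-bound 1 f _ = s≤s (s≤s z≤n)
≥2-but-first-two⇒sum-bound (suc (suc m)) f 2≤f = +-monoʳ-≤ 4 (begin
  m * 2
    ≤⟨ m*k≤sum-applyUpTo m (f ∘ suc ∘ suc) (λ i i<m → 2≤f (2 + i) (s≤s (s≤s z≤n)) (s≤s (s≤s i<m))) ⟩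
  sum (applyUpTo (f ∘ suc ∘ suc) m)
    ≤⟨ m≤n+m _ (f 0 + f 1) ⟩
  f 0 + f 1 + sum (applyUpTo (f ∘ suc ∘ suc) m)
    ≡⟨ +-assoc (f 0) (f 1) _ ⟩
  sum (applyUpTo f (2 + m))
    ∎)
  where open ≤-Reasoning

≥2-but-last-two⇒sum-bound : ∀ m (f : ℕ → ℕ) → (∀ i → 2 + i < m → 2 ≤ f i) →
  m * 2 ≤ 4 + sum (applyUpTo f m)
≥2-but-last-two⇒sum-bound 0 f _ = z≤n
≥2-but-last-two⇒sum-bound 1 f _ = s≤s (s≤s z≤n)
≥2-but-last-two⇒sum-bound 2 f _ = s≤s (s≤s (s≤s (s≤s z≤n)))
≥2-but-last-two⇒sum-bound (suc m@(suc (suc _))) f 2≤f = begin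
  2 + m * 2
    ≤⟨ +-mono-≤ (2≤f 0 (s≤s (s≤s (s≤s z≤n))))
                (≥2-but-last-two⇒sum-bound m (f ∘ suc) (λ i lt → 2≤f (suc i) (s≤s lt))) ⟩
  f 0 + (4 + sum (applyUpTo (f ∘ suc) m))
    ≡⟨ x∙yz≈y∙xz (f 0) 4 _ ⟩
  4 + sum (applyUpTo f (suc m))
    ∎
  where open ≤-Reasoning

Odd : ℕ → Set
Odd x = parity x ≡ 1ℙ

odd⇒1+[2≤]≤ : ∀ x → Odd x → 1 + ⌊ 2 ≤? x ⌋ℕ ≤ x
odd⇒1+[2≤]≤ 1 _ = ≤-refl
odd⇒1+[2≤]≤ (suc (suc (suc x))) _ = s≤s (s≤s z≤n)

odd-distinct⇒2+[2≤]≤ : ∀ x y → Odd x → Odd y → x ≢ y → 2 + ⌊ 2 ≤? x ⌋ℕ ≤ x + ⌊ 2 ≤? y ⌋ℕ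
odd-distinct⇒2+[2≤]≤ 1 1 _ _ 1≢1 = contradiction refl 1≢1
odd-distinct⇒2+[2≤]≤ 1 (suc (suc (suc y))) _ _ _ = ≤-refl
odd-distinct⇒2+[2≤]≤ (suc (suc (suc x))) y _ _ _ = s≤s (s≤s (s≤s z≤n))

-- The indicators ⌊ 2 ≤? f 0 ⌋ℕ and ⌊ 2 ≤? f 1 ⌋ℕ are the slack that pays for the next value:
-- two odd values two apart are distinct, so at most one of them is 1.
odd-distinct⇒sum-bound′ : ∀ k (f : ℕ → ℕ) → (∀ i → i < 2 + k → Odd (f i)) →
  DistinctTwoApart (2 + k) f →
  ⌊ 2 ≤? f 0 ⌋ℕ + ⌊ 2 ≤? f 1 ⌋ℕ + (2 + k) * 2 ≤ 2 + sum (applyUpTo f (2 + k))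
odd-distinct⇒sum-bound′ zero f odd _ = begin
  L 0 + L 1 + 4                 ≡⟨ rearrange (L 0) (L 1) ⟩
  (1 + L 0) + (1 + L 1) + 2     ≤⟨ +-monoˡ-≤ 2 (+-mono-≤ (odd⇒1+[2≤]≤ (f 0) (odd 0 z<s))
                                                         (odd⇒1+[2≤]≤ (f 1) (odd 1 (s≤s z<s)))) ⟩
  f 0 + f 1 + 2                 ≡⟨ rearrange′ (f 0) (f 1) ⟩
  2 + (f 0 + (f 1 + 0))         ∎
  where
  open ≤-Reasoning
  L : ℕ → ℕ
  L i = ⌊ 2 ≤? f i ⌋ℕ
  rearrange : ∀ a b → a + b + 4 ≡ (1 + a) + (1 + b) + 2
  rearrange = solve-∀
  rearrange′ : ∀ a b → a + b + 2 ≡ 2 + (a + (b + 0))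
  rearrange′ = solve-∀
odd-distinct⇒sum-bound′ (suc k) f odd d = +-cancelʳ-≤ (L 2) _ _ (begin
  L 0 + L 1 + (3 + k) * 2 + L 2              ≡⟨ rearrange (L 0) (L 1) (L 2) k ⟩
  (2 + L 0) + (L 1 + L 2 + (2 + k) * 2)     ≤⟨ +-mono-≤ first rest ⟩
  (f 0 + L 2) + (2 + S)                      ≡⟨ rearrange′ (f 0) (L 2) S ⟩
  2 + (f 0 + S) + L 2                        ∎)
  where
  open ≤-Reasoning
  L : ℕ → ℕ
  L i = ⌊ 2 ≤? f i ⌋ℕ
  S : ℕ
  S = sum (applyUpTo (f ∘ suc) (2 + k))
  first : 2 + L 0 ≤ f 0 + L 2
  first = odd-distinct⇒2+[2≤]≤ (f 0) (f 2) (odd 0 z<s) (odd 2 (s≤s (s≤s z<s))) (d 0 (s≤s (s≤s z<s)))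
  rest : L 1 + L 2 + (2 + k) * 2 ≤ 2 + S
  rest = odd-distinct⇒sum-bound′ k (f ∘ suc) (λ i lt → odd (suc i) (s≤s lt)) (λ j lt → d (suc j) (s≤s lt))
  rearrange : ∀ a b c k → a + b + (3 + k) * 2 + c ≡ (2 + a) + (b + c + (2 + k) * 2)
  rearrange = solve-∀
  rearrange′ : ∀ a b c → (a + b) + (2 + c) ≡ 2 + (a + c) + b
  rearrange′ = solve-∀

odd-distinct⇒sum-bound : ∀ m (f : ℕ → ℕ) → (∀ i → i < m → Odd (f i)) → DistinctTwoApart m f →
  m * 2 ≤ 2 + sum (applyUpTo f m)
odd-distinct⇒sum-bound 0 f _ _ = z≤n
odd-distinct⇒sum-bound 1 f _ _ = m≤m+n 2 _
odd-distinct⇒sum-bound (suc (suc k)) f odd d =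
  ≤-trans (m≤n+m _ (⌊ 2 ≤? f 0 ⌋ℕ + ⌊ 2 ≤? f 1 ⌋ℕ)) (odd-distinct⇒sum-bound′ k f odd d)

three-regions⇒sum-bound : ∀ {a c n} (f : ℕ → ℕ) → a ≤ c → c ≤ n → DistinctTwoApart n f →
  (∀ i → 2 ≤ i → i < a → 2 ≤ f i) →
  (∀ i → a ≤ i → i < c → Odd (f i)) →
  (∀ i → c ≤ i → 2 + i < n → 2 ≤ f i) →
  n * 2 ≤ 10 + sum (applyUpTo f n)
three-regions⇒sum-bound {a} f a≤c c≤n distinct left middle right
  with m , refl ← m≤n⇒∃[o]m+o≡n a≤c | r , refl ← m≤n⇒∃[o]m+o≡n c≤n = begin
  (a + m + r) * 2                 ≡⟨ distrib a m r ⟩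
  a * 2 + m * 2 + r * 2           ≤⟨ +-mono-≤ (+-mono-≤ left-bound middle-bound) right-bound ⟩
  (4 + SA) + (2 + SB) + (4 + SC)  ≡⟨ collect SA SB SC ⟩
  10 + (SA + SB + SC)             ≡⟨ cong (10 +_) (sym split) ⟩
  10 + sum (applyUpTo f (a + m + r)) ∎
  where
  open ≤-Reasoning
  SA SB SC : ℕ
  SA = sum (applyUpTo f a)
  SB = sum (applyUpTo (λ i → f (a + i)) m)
  SC = sum (applyUpTo (λ i → f (a + m + i)) r)
  split : sum (applyUpTo f (a + m + r)) ≡ SA + SB + SC
  split = trans (sum-applyUpTo-split f (a + m) r) (cong (_+ SC) (sum-applyUpTo-split f a m))
  left-bound : a * 2 ≤ 4 + SA
  left-bound = ≥2-but-first-two⇒sum-bound a f left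
  middle-bound : m * 2 ≤ 2 + SB
  middle-bound = odd-distinct⇒sum-bound m (λ i → f (a + i))
    (λ i i<m → middle (a + i) (m≤m+n a i) (+-monoʳ-< a i<m))
    (distinctTwoApart-drop a (λ j lt → distinct j (<-≤-trans lt (m≤m+n (a + m) r))))
  shift : ∀ x i → x + (2 + i) ≡ 2 + (x + i)
  shift = solve-∀
  right-bound : r * 2 ≤ 4 + SC
  right-bound = ≥2-but-last-two⇒sum-bound r (λ i → f (a + m + i))
    (λ i lt → right (a + m + i) (m≤m+n (a + m) i)
                 (subst (_< a + m + r) (shift (a + m) i) (+-monoʳ-< (a + m) lt)))
  distrib : ∀ a m r → (a + m + r) * 2 ≡ a * 2 + m * 2 + r * 2
  distrib = solve-∀
  collect : ∀ x y z → (4 + x) + (2 + y) + (4 + z) ≡ 10 + (x + y + z)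
  collect = solve-∀

≢⇒1≤+ : ∀ {x y} → x ≢ y → 1 ≤ x + y
≢⇒1≤+ {zero}  {zero}  0≢0 = contradiction refl 0≢0
≢⇒1≤+ {zero}  {suc _} _   = s≤s z≤n
≢⇒1≤+ {suc _} {_}     _   = s≤s z≤n

distinctTwoApart⇒1≤sum : ∀ k f → DistinctTwoApart (3 + k) f → 1 ≤ sum (applyUpTo f (3 + k))
distinctTwoApart⇒1≤sum k f distinct =
  ≤-trans (≢⇒1≤+ (distinct 0 (s≤s (s≤s (s≤s z≤n)))))
    (+-monoʳ-≤ (f 0) (≤-trans (m≤m+n (f 2) _) (m≤n+m _ (f 1))))

distinctTwoApart⇒2≤sum : ∀ k f → DistinctTwoApart (4 + k) f → 2 ≤ sum (applyUpTo f (4 + k))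
distinctTwoApart⇒2≤sum k f distinct = begin
  1 + 1                           ≤⟨ +-mono-≤ (≢⇒1≤+ (distinct 0 (s≤s (s≤s (s≤s z≤n)))))
                                               (≢⇒1≤+ (distinct 1 (s≤s (s≤s (s≤s (s≤s z≤n)))))) ⟩
  (f 0 + f 2) + (f 1 + f 3)       ≤⟨ m≤m+n _ rest ⟩
  (f 0 + f 2) + (f 1 + f 3) + rest ≡⟨ regroup (f 0) (f 1) (f 2) (f 3) rest ⟩
  sum (applyUpTo f (4 + k))       ∎
  where
  open ≤-Reasoning
  rest : ℕ
  rest = sum (applyUpTo (λ i → f (4 + i)) k)
  regroup : ∀ a b c d e → (a + c) + (b + d) + e ≡ a + (b + (c + (d + e)))
  regroup = solve-∀

-- Walks on the path of natural numbers

infix 4 _∼_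

data _∼_ (x y : ℕ) : Set where
  up   : suc x ≡ y → x ∼ y
  down : suc y ≡ x → x ∼ y

infixr 5 _∷_

data Walk : ℕ → ℕ → List ℕ → Set where
  [-] : ∀ {a} → Walk a a (a ∷ [])
  _∷_ : ∀ {a b c vs} → a ∼ b → Walk b c (b ∷ vs) → Walk a c (a ∷ b ∷ vs)

walk-shift : ∀ s {a c V} → Walk a c V → Walk (a + s) (c + s) (map (_+ s) V)
walk-shift s [-]             = [-]
walk-shift s (up refl ∷ w)   = up refl ∷ walk-shift s w
walk-shift s (down refl ∷ w) = down refl ∷ walk-shift s w

walkLength-map : ∀ {A B : Set} (f : A → B) (xs : List A) → walkLength (map f xs) ≡ walkLength xs
walkLength-map f []           = refl
walkLength-map f (_ ∷ [])     = refl
walkLength-map f (_ ∷ y ∷ xs) = cong suc (walkLength-map f (y ∷ xs))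

walkLength-++ : ∀ {A : Set} (xs : List A) y ys → walkLength (xs ++ y ∷ ys) ≡ length xs + walkLength (y ∷ ys)
walkLength-++ []           y ys = refl
walkLength-++ (x ∷ [])     y ys = refl
walkLength-++ (x ∷ x′ ∷ xs) y ys = cong suc (walkLength-++ (x′ ∷ xs) y ys)

walk-++ : ∀ xs {a b c ys} → Walk a b (xs ∷ʳ b) → Walk b c (b ∷ ys) → Walk a c (xs ++ b ∷ ys)
walk-++ []            [-]           w = w
walk-++ (_ ∷ [])      (s ∷ [-])     w = s ∷ w
walk-++ (_ ∷ x′ ∷ xs) (s ∷ prefix) w = s ∷ walk-++ (x′ ∷ xs) prefix w

-- Edge j joins j and j + 1, so a step between adjacent a and b crosses edge a ⊓ b.
traversals : List ℕ → ℕ → ℕ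
traversals (a ∷ b ∷ vs) j = ⌊ a ⊓ b ≟ j ⌋ℕ + traversals (b ∷ vs) j
traversals _            _ = 0

traversals-++ : ∀ xs y ys j → traversals (xs ++ y ∷ ys) j ≡ traversals (xs ∷ʳ y) j + traversals (y ∷ ys) j
traversals-++ []            y ys j = refl
traversals-++ (x ∷ [])      y ys j = cong (_+ traversals (y ∷ ys) j) (sym (+-identityʳ _))
traversals-++ (x ∷ x′ ∷ xs) y ys j =
  trans (cong (⌊ x ⊓ x′ ≟ j ⌋ℕ +_) (traversals-++ (x′ ∷ xs) y ys j))
    (sym (+-assoc ⌊ x ⊓ x′ ≟ j ⌋ℕ (traversals ((x′ ∷ xs) ∷ʳ y) j) _))

traversals-shift : ∀ s V j → traversals (map (_+ s) V) (j + s) ≡ traversals V j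
traversals-shift s (a ∷ b ∷ vs) j = cong₂ _+_
  (⌊⌋ℕ-cong (λ e → +-cancelʳ-≡ s _ _ (trans (+-distribʳ-⊓ s a b) e))
            (λ e → trans (sym (+-distribʳ-⊓ s a b)) (cong (_+ s) e)) _ _)
  (traversals-shift s (b ∷ vs) j)
traversals-shift s []       j = refl
traversals-shift s (_ ∷ []) j = refl

∼⇒⊓< : ∀ {x y j} → x ∼ y → x ≤ j → y ≤ j → x ⊓ y < j
∼⇒⊓< {x} (up refl) _   y≤j = subst (_< _) (sym (m≤n⇒m⊓n≡m (n≤1+n x))) y≤j
∼⇒⊓< {y = y} (down refl) x≤j _ = subst (_< _) (sym (m≥n⇒m⊓n≡n (n≤1+n y))) x≤j

traversals-below : ∀ {i j} V → i ≤ j → All (j <_) V → traversals V i ≡ 0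
traversals-below []           _   _                   = refl
traversals-below (_ ∷ [])     _   _                   = refl
traversals-below (a ∷ b ∷ vs) i≤j (j<a ∷ j<b ∷ j<vs) = cong₂ _+_
  (⌊⌋ℕ≡0 (a ⊓ b ≟ _) (λ e → <⇒≢ (≤-<-trans i≤j (⊓-glb j<a j<b)) (sym e)))
  (traversals-below (b ∷ vs) i≤j (j<b ∷ j<vs))

traversals-above : ∀ {i j a c V} → j ≤ i → Walk a c V → All (_≤ j) V → traversals V i ≡ 0
traversals-above j≤i [-]     _                       = refl
traversals-above j≤i (s ∷ w) (a≤j ∷ b≤j∷vs@(b≤j ∷ _)) = cong₂ _+_
  (⌊⌋ℕ≡0 (_ ≟ _) (<⇒≢ (<-≤-trans (∼⇒⊓< s a≤j b≤j) j≤i)))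
  (traversals-above j≤i w b≤j∷vs)

traversals≡0⇒below : ∀ {j a c V} → Walk a c V → traversals V j ≡ 0 → j < a → All (j <_) V
traversals≡0⇒below [-] _ j<a = j<a ∷ []
traversals≡0⇒below {j} (_∷_ {a} {b} s w) none j<a =
  j<a ∷ traversals≡0⇒below w (m+n≡0⇒n≡0 ⌊ a ⊓ b ≟ j ⌋ℕ none) (j<b s)
  where
  a⊓b≢j : a ⊓ b ≢ j
  a⊓b≢j = ⌊⌋ℕ≡0⇒¬ (a ⊓ b ≟ j) (m+n≡0⇒m≡0 _ none)
  j<b : a ∼ b → j < b
  j<b (up refl) = m<n⇒m<1+n j<a
  j<b (down refl) = ≤∧≢⇒< (s≤s⁻¹ j<a) (λ j≡b → a⊓b≢j (trans (m≥n⇒m⊓n≡n (n≤1+n b)) (sym j≡b)))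

traversals≡0⇒above : ∀ {j a c V} → Walk a c V → traversals V j ≡ 0 → a ≤ j → All (_≤ j) V
traversals≡0⇒above [-] _ a≤j = a≤j ∷ []
traversals≡0⇒above {j} (_∷_ {a} {b} s w) none a≤j =
  a≤j ∷ traversals≡0⇒above w (m+n≡0⇒n≡0 ⌊ a ⊓ b ≟ j ⌋ℕ none) (b≤j s)
  where
  a⊓b≢j : a ⊓ b ≢ j
  a⊓b≢j = ⌊⌋ℕ≡0⇒¬ (a ⊓ b ≟ j) (m+n≡0⇒m≡0 _ none)
  b≤j : a ∼ b → b ≤ j
  b≤j (up refl) = ≤∧≢⇒< a≤j (λ a≡j → a⊓b≢j (trans (m≤n⇒m⊓n≡m (n≤1+n a)) a≡j))
  b≤j (down refl) = ≤-trans (n≤1+n b) a≤j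

sum-traversals≤walkLength : ∀ n V → sum (applyUpTo (traversals V) n) ≤ walkLength V
sum-traversals≤walkLength n []           = ≤-reflexive (sum-applyUpTo-zero n)
sum-traversals≤walkLength n (_ ∷ [])     = ≤-reflexive (sum-applyUpTo-zero n)
sum-traversals≤walkLength n (a ∷ b ∷ vs) = begin
  sum (applyUpTo (traversals (a ∷ b ∷ vs)) n)
    ≡⟨ sum-applyUpTo-distrib (λ j → ⌊ a ⊓ b ≟ j ⌋ℕ) (traversals (b ∷ vs)) n ⟩
  sum (applyUpTo (λ j → ⌊ a ⊓ b ≟ j ⌋ℕ) n) + sum (applyUpTo (traversals (b ∷ vs)) n)
    ≡⟨ cong (_+ _) (sum-applyUpTo-≟ (a ⊓ b) n) ⟩
  ⌊ a ⊓ b <? n ⌋ℕ + sum (applyUpTo (traversals (b ∷ vs)) n)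
    ≤⟨ +-mono-≤ (⌊⌋ℕ≤1 (a ⊓ b <? n)) (sum-traversals≤walkLength n (b ∷ vs)) ⟩
  1 + walkLength (b ∷ vs)
    ∎
  where open ≤-Reasoning

side : ℕ → ℕ → Parity
side j a = parity ⌊ j <? a ⌋ℕ

side-≤ : ∀ {j a} → a ≤ j → side j a ≡ 0ℙ
side-≤ a≤j = cong parity (⌊⌋ℕ≡0 (_ <? _) (≤⇒≯ a≤j))

side-> : ∀ {j a} → j < a → side j a ≡ 1ℙ
side-> j<a = cong parity (⌊⌋ℕ≡1 (_ <? _) j<a)

ℙ-+-cancel-middle : ∀ x y z → x ℙ.+ y ℙ.+ (y ℙ.+ z) ≡ x ℙ.+ z
ℙ-+-cancel-middle 0ℙ 0ℙ z = refl
ℙ-+-cancel-middle 0ℙ 1ℙ z = ⁻¹-involutive z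
ℙ-+-cancel-middle 1ℙ 0ℙ z = refl
ℙ-+-cancel-middle 1ℙ 1ℙ z = refl

up-parity : ∀ a j → parity ⌊ a ⊓ suc a ≟ j ⌋ℕ ≡ side j a ℙ.+ side j (suc a)
up-parity a j rewrite m≤n⇒m⊓n≡m (n≤1+n a) with <-cmp a j
... | tri< a<j _ _ = trans (cong parity (⌊⌋ℕ≡0 (a ≟ j) (<⇒≢ a<j)))
                           (sym (cong₂ ℙ._+_ (side-≤ (<⇒≤ a<j)) (side-≤ a<j)))
... | tri≈ _ refl _ = trans (cong parity (⌊⌋ℕ≡1 (a ≟ a) refl))
                            (sym (cong₂ ℙ._+_ (side-≤ {a} ≤-refl) (side-> {a} ≤-refl)))
... | tri> _ _ j<a = trans (cong parity (⌊⌋ℕ≡0 (a ≟ j) (≢-sym (<⇒≢ j<a))))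
                           (sym (cong₂ ℙ._+_ (side-> j<a) (side-> (m<n⇒m<1+n j<a))))

∼-parity : ∀ {a b} j → a ∼ b → parity ⌊ a ⊓ b ≟ j ⌋ℕ ≡ side j a ℙ.+ side j b
∼-parity {a} j (up refl) = up-parity a j
∼-parity {b = b} j (down refl) = begin
  parity ⌊ suc b ⊓ b ≟ j ⌋ℕ      ≡⟨ cong (λ x → parity ⌊ x ≟ j ⌋ℕ) (⊓-comm (suc b) b) ⟩
  parity ⌊ b ⊓ suc b ≟ j ⌋ℕ      ≡⟨ up-parity b j ⟩
  side j b ℙ.+ side j (suc b)     ≡⟨ ℙ-+-comm (side j b) _ ⟩
  side j (suc b) ℙ.+ side j b     ∎
  where open ≡-Reasoning

traversals-parity : ∀ j {a c V} → Walk a c V → parity (traversals V j) ≡ side j a ℙ.+ side j c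
traversals-parity j {a} [-] = sym (proj₁ +-inverse (side j a))
traversals-parity j {a} {c} (_∷_ {b = b} {vs = vs} s w) = begin
  parity (⌊ a ⊓ b ≟ j ⌋ℕ + traversals (b ∷ vs) j)
    ≡⟨ +-homo-+ ⌊ a ⊓ b ≟ j ⌋ℕ _ ⟩
  parity ⌊ a ⊓ b ≟ j ⌋ℕ ℙ.+ parity (traversals (b ∷ vs) j)
    ≡⟨ cong₂ ℙ._+_ (∼-parity j s) (traversals-parity j w) ⟩
  side j a ℙ.+ side j b ℙ.+ (side j b ℙ.+ side j c)
    ≡⟨ ℙ-+-cancel-middle (side j a) (side j b) (side j c) ⟩
  side j a ℙ.+ side j c
    ∎
  where open ≡-Reasoning

-- The length bound 2n − 10

even-nonzero⇒≥2 : ∀ x → parity x ≡ 0ℙ → x ≢ 0 → 2 ≤ x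
even-nonzero⇒≥2 0 _ x≢0 = contradiction refl x≢0
even-nonzero⇒≥2 (suc (suc x)) _ _ = s≤s (s≤s z≤n)

module _ {n a c V} (w : Walk a c V) (distinct : DistinctTwoApart n (traversals V)) where

  left-edge-≥2 : ∀ i → 2 ≤ i → i < a → i < c → i < n → 2 ≤ traversals V i
  left-edge-≥2 (suc (suc i)) (s≤s (s≤s z≤n)) i<a i<c i<n = even-nonzero⇒≥2 _ even nonzero
    where
    even : parity (traversals V (2 + i)) ≡ 0ℙ
    even = trans (traversals-parity _ w) (cong₂ ℙ._+_ (side-> i<a) (side-> i<c))
    nonzero : traversals V (2 + i) ≢ 0
    nonzero none = distinct i i<n
      (trans (traversals-below V (m≤n+m i 2) (traversals≡0⇒below w none i<a)) (sym none))

  right-edge-≥2 : ∀ i → a ≤ i → c ≤ i → 2 + i < n → 2 ≤ traversals V i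
  right-edge-≥2 i a≤i c≤i 2+i<n = even-nonzero⇒≥2 _ even nonzero
    where
    even : parity (traversals V i) ≡ 0ℙ
    even = trans (traversals-parity i w) (cong₂ ℙ._+_ (side-≤ a≤i) (side-≤ c≤i))
    nonzero : traversals V i ≢ 0
    nonzero none = distinct i 2+i<n
      (trans none (sym (traversals-above (m≤n+m i 2) w (traversals≡0⇒above w none a≤i))))

  walk-sum-bound : a ≤ n → c ≤ n → n * 2 ≤ 10 + sum (applyUpTo (traversals V) n)
  walk-sum-bound a≤n c≤n with ≤-total a c
  ... | inj₁ a≤c = three-regions⇒sum-bound (traversals V) a≤c c≤n distinct
    (λ i 2≤i i<a → left-edge-≥2 i 2≤i i<a (<-≤-trans i<a a≤c) (<-≤-trans i<a a≤n))
    (λ i a≤i i<c → trans (traversals-parity i w) (cong₂ ℙ._+_ (side-≤ a≤i) (side-> i<c)))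
    (λ i c≤i → right-edge-≥2 i (≤-trans a≤c c≤i) c≤i)
  ... | inj₂ c≤a = three-regions⇒sum-bound (traversals V) c≤a a≤n distinct
    (λ i 2≤i i<c → left-edge-≥2 i 2≤i (<-≤-trans i<c c≤a) i<c (<-≤-trans i<c c≤n))
    (λ i c≤i i<a → trans (traversals-parity i w) (cong₂ ℙ._+_ (side-> i<a) (side-≤ c≤i)))
    (λ i a≤i → right-edge-≥2 i a≤i (≤-trans c≤a a≤i))

pathDegree : ℕ → ℕ → ℕ
pathDegree n y = ⌊ y <? n ⌋ℕ + ⌊ 0 <? y ⌋ℕ

tabulate-toℕ : ∀ {A : Set} n (f : ℕ → A) → tabulate {n = n} (f ∘ toℕ) ≡ applyUpTo f n
tabulate-toℕ zero    f = refl
tabulate-toℕ (suc n) f = cong (f 0 ∷_) (tabulate-toℕ n (f ∘ suc))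

pathAdj-indicator : ∀ {k} (x u : Fin k) →
  ⌊ pathAdj? x u ⌋ℕ ≡ ⌊ suc (toℕ x) ≟ toℕ u ⌋ℕ + ⌊ suc (toℕ u) ≟ toℕ x ⌋ℕ
pathAdj-indicator x u with suc (toℕ x) ≟ toℕ u | suc (toℕ u) ≟ toℕ x
... | yes p | yes q = contradiction (trans (cong suc p) q) (≢-sym (<⇒≢ (m<n⇒m<1+n (n<1+n _))))
... | yes _ | no _  = refl
... | no _  | yes _ = refl
... | no _  | no _  = refl

sum-predecessor-indicator : ∀ {n y} → y ≤ n →
  sum (applyUpTo (λ j → ⌊ suc j ≟ y ⌋ℕ) (suc n)) ≡ ⌊ 0 <? y ⌋ℕ
sum-predecessor-indicator {n} {zero}  _   = sum-applyUpTo-zero (suc n)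
sum-predecessor-indicator {n} {suc y} y<n = begin
  sum (applyUpTo (λ j → ⌊ suc j ≟ suc y ⌋ℕ) (suc n))
    ≡⟨ sum-applyUpTo-cong (suc n) (λ j → ⌊⌋ℕ-cong (sym ∘ suc-injective) (cong suc ∘ sym) (suc j ≟ suc y) (y ≟ j)) ⟩
  sum (applyUpTo (λ j → ⌊ y ≟ j ⌋ℕ) (suc n))
    ≡⟨ sum-applyUpTo-≟ y (suc n) ⟩
  ⌊ y <? suc n ⌋ℕ
    ≡⟨ ⌊⌋ℕ≡1 (y <? suc n) (m<n⇒m<1+n y<n) ⟩
  1
    ∎
  where open ≡-Reasoning

deg-P : ∀ n (x : Fin (suc n)) → deg (P n) x ≡ pathDegree n (toℕ x)
deg-P n x = begin
  sum (map (λ u → ⌊ pathAdj? x u ⌋ℕ) (allFin (suc n)))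
    ≡⟨ cong sum (map-tabulate id (λ u → ⌊ pathAdj? x u ⌋ℕ)) ⟩
  sum (tabulate (λ u → ⌊ pathAdj? x u ⌋ℕ))
    ≡⟨ cong sum (tabulate-cong {n = suc n} (pathAdj-indicator x)) ⟩
  sum (tabulate {n = suc n} ((λ j → ⌊ suc y ≟ j ⌋ℕ + ⌊ suc j ≟ y ⌋ℕ) ∘ toℕ))
    ≡⟨ cong sum (tabulate-toℕ (suc n) (λ j → ⌊ suc y ≟ j ⌋ℕ + ⌊ suc j ≟ y ⌋ℕ)) ⟩
  sum (applyUpTo (λ j → ⌊ suc y ≟ j ⌋ℕ + ⌊ suc j ≟ y ⌋ℕ) (suc n))
    ≡⟨ sum-applyUpTo-distrib (λ j → ⌊ suc y ≟ j ⌋ℕ) (λ j → ⌊ suc j ≟ y ⌋ℕ) (suc n) ⟩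
  sum (applyUpTo (λ j → ⌊ suc y ≟ j ⌋ℕ) (suc n)) + sum (applyUpTo (λ j → ⌊ suc j ≟ y ⌋ℕ) (suc n))
    ≡⟨ cong₂ _+_ (trans (sum-applyUpTo-≟ (suc y) (suc n)) (⌊⌋ℕ-cong s≤s⁻¹ s≤s (suc y <? suc n) (y <? n)))
                 (sum-predecessor-indicator (toℕ≤pred[n] x)) ⟩
  ⌊ y <? n ⌋ℕ + ⌊ 0 <? y ⌋ℕ
    ∎
  where
  open ≡-Reasoning
  y : ℕ
  y = toℕ x

incidences : ℕ → List ℕ → ℕ
incidences y (a ∷ b ∷ vs) = ⌊ a ≟ y ⌋ℕ + ⌊ b ≟ y ⌋ℕ + incidences y (b ∷ vs)
incidences y _            = 0

extra≡incidences : ∀ {k} (x : Fin k) W → extra x W ≡ incidences (toℕ x) (map toℕ W)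
extra≡incidences x []           = refl
extra≡incidences x (_ ∷ [])     = refl
extra≡incidences x (a ∷ b ∷ ws) =
  cong₂ _+_ (cong₂ _+_ (toℕ-indicator a) (toℕ-indicator b)) (extra≡incidences x (b ∷ ws))
  where
  toℕ-indicator : ∀ u → ⌊ u Fin.≟ x ⌋ℕ ≡ ⌊ toℕ u ≟ toℕ x ⌋ℕ
  toℕ-indicator u = ⌊⌋ℕ-cong (cong toℕ) toℕ-injective (u Fin.≟ x) (toℕ u ≟ toℕ x)

∼-incidences-zero : ∀ {a b} → a ∼ b → ⌊ a ≟ 0 ⌋ℕ + ⌊ b ≟ 0 ⌋ℕ ≡ ⌊ a ⊓ b ≟ 0 ⌋ℕ
∼-incidences-zero {a} (up refl)     rewrite m≤n⇒m⊓n≡m (n≤1+n a) = +-identityʳ _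
∼-incidences-zero {b = b} (down refl) rewrite m≥n⇒m⊓n≡n (n≤1+n b) = refl

∼-incidences-suc : ∀ {a b} y → a ∼ b →
  ⌊ a ≟ suc y ⌋ℕ + ⌊ b ≟ suc y ⌋ℕ ≡ ⌊ a ⊓ b ≟ suc y ⌋ℕ + ⌊ a ⊓ b ≟ y ⌋ℕ
∼-incidences-suc {a} y (up refl) rewrite m≤n⇒m⊓n≡m (n≤1+n a) =
  cong (⌊ a ≟ suc y ⌋ℕ +_) (⌊⌋ℕ-cong suc-injective (cong suc) (suc a ≟ suc y) (a ≟ y))
∼-incidences-suc {b = b} y (down refl) rewrite m≥n⇒m⊓n≡n (n≤1+n b) =
  trans (+-comm ⌊ suc b ≟ suc y ⌋ℕ _)
        (cong (⌊ b ≟ suc y ⌋ℕ +_) (⌊⌋ℕ-cong suc-injective (cong suc) (suc b ≟ suc y) (b ≟ y)))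

incidences-zero : ∀ {a c V} → Walk a c V → incidences 0 V ≡ traversals V 0
incidences-zero [-]     = refl
incidences-zero (s ∷ w) = cong₂ _+_ (∼-incidences-zero s) (incidences-zero w)

incidences-suc : ∀ {a c V} y → Walk a c V → incidences (suc y) V ≡ traversals V (suc y) + traversals V y
incidences-suc y [-] = refl
incidences-suc y (_∷_ {a} {b} {vs = vs} s w) =
  trans (cong₂ _+_ (∼-incidences-suc y s) (incidences-suc y w))
        (interchange ⌊ a ⊓ b ≟ suc y ⌋ℕ _ (traversals (b ∷ vs) (suc y)) _)

degree : ℕ → List ℕ → ℕ → ℕ
degree n V y = pathDegree n y + incidences y V

degPlus-P : ∀ n W (x : Fin (suc n)) → degPlus (P n) W x ≡ degree n (map toℕ W) (toℕ x)
degPlus-P n W x = cong₂ _+_ (deg-P n x) (extra≡incidences x W)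

isWalk⇒walk : ∀ {n x xs} → IsWalk (P n) (x ∷ xs) →
  ∃ λ (y : Fin (suc n)) → Walk (toℕ x) (toℕ y) (map toℕ (x ∷ xs))
isWalk⇒walk (single x)      = x , [-]
isWalk⇒walk (step adj iw) with y , w ← isWalk⇒walk iw = y , pathAdj⇒∼ adj ∷ w
  where
  pathAdj⇒∼ : ∀ {k} {u v : Fin k} → PathAdj u v → toℕ u ∼ toℕ v
  pathAdj⇒∼ (fwd p) = up p
  pathAdj⇒∼ (bwd p) = down p

walk⇒isWalk : ∀ {n a c} W → Walk a c (map toℕ W) → IsWalk (P n) W
walk⇒isWalk (x ∷ [])     [-]     = single x
walk⇒isWalk (x ∷ y ∷ ws) (s ∷ w) = step (∼⇒pathAdj s) (walk⇒isWalk (y ∷ ws) w)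
  where
  ∼⇒pathAdj : ∀ {k} {u v : Fin k} → toℕ u ∼ toℕ v → PathAdj u v
  ∼⇒pathAdj (up p)   = fwd p
  ∼⇒pathAdj (down p) = bwd p

toFin : ∀ {n} V → All (_≤ n) V → List (Fin (suc n))
toFin []      []          = []
toFin (v ∷ V) (v≤n ∷ V≤n) = fromℕ< (s≤s v≤n) ∷ toFin V V≤n

map-toℕ-toFin : ∀ {n} V (V≤n : All (_≤ n) V) → map toℕ (toFin V V≤n) ≡ V
map-toℕ-toFin []      []          = refl
map-toℕ-toFin (v ∷ V) (v≤n ∷ V≤n) = cong₂ _∷_ (toℕ-fromℕ< (s≤s v≤n)) (map-toℕ-toFin V V≤n)

module _ {n a c : ℕ} {V : List ℕ} (w : Walk a c V) where

  degree-first : 0 < n → degree n V 0 ≡ 1 + traversals V 0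
  degree-first 0<n = cong₂ _+_ (cong (_+ 0) (⌊⌋ℕ≡1 (0 <? n) 0<n)) (incidences-zero w)

  degree-inner : ∀ y → suc y < n → degree n V (suc y) ≡ 2 + (traversals V (suc y) + traversals V y)
  degree-inner y 1+y<n = cong₂ _+_ (cong (_+ 1) (⌊⌋ℕ≡1 (suc y <? n) 1+y<n)) (incidences-suc y w)

  degree-last : ∀ y → suc y ≡ n → All (_≤ n) V → degree n V (suc y) ≡ 1 + traversals V y
  degree-last y refl V≤n = cong₂ _+_ (cong (_+ 1) (⌊⌋ℕ≡0 (suc y <? suc y) (<-irrefl refl)))
    (trans (incidences-suc y w) (cong (_+ traversals V y) (traversals-above ≤-refl w V≤n)))

  consecutive-degrees-≢ : 2 ≤ n → All (_≤ n) V → DistinctTwoApart n (traversals V) →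
    ∀ y → suc y ≤ n → degree n V y ≢ degree n V (suc y)
  consecutive-degrees-≢ 2≤n _ _ zero _ eq =
    <⇒≢ (s≤s (m≤n+m T0 (traversals V 1)))
      (suc-injective (trans (sym (degree-first (<-≤-trans z<s 2≤n))) (trans eq (degree-inner 0 2≤n))))
    where
    T0 : ℕ
    T0 = traversals V 0
  consecutive-degrees-≢ _ V≤n distinct (suc j) 2+j≤n eq with m≤n⇒m<n∨m≡n 2+j≤n
  ... | inj₁ 2+j<n = distinct j 2+j<n (+-cancelˡ-≡ (traversals V (suc j)) _ _ (begin
    traversals V (suc j) + traversals V j        ≡⟨ suc-injective (suc-injective (trans outer (trans eq inner))) ⟩
    traversals V (2 + j) + traversals V (suc j)  ≡⟨ +-comm (traversals V (2 + j)) _ ⟩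
    traversals V (suc j) + traversals V (2 + j)  ∎))
    where
    open ≡-Reasoning
    outer : 2 + (traversals V (suc j) + traversals V j) ≡ degree n V (suc j)
    outer = sym (degree-inner j (<-trans (n<1+n _) 2+j<n))
    inner : degree n V (2 + j) ≡ 2 + (traversals V (2 + j) + traversals V (suc j))
    inner = degree-inner (suc j) 2+j<n
  ... | inj₂ 2+j≡n = <⇒≢ (s≤s (m≤m+n (traversals V (suc j)) (traversals V j)))
    (sym (suc-injective (trans (sym (degree-inner j (subst (suc j <_) 2+j≡n ≤-refl)))
                               (trans eq (degree-last (suc j) 2+j≡n V≤n)))))

All-toℕ≤ : ∀ {n} (W : List (Fin (suc n))) → All (_≤ n) (map toℕ W)
All-toℕ≤ W = All.map⁺ (All.universal toℕ≤pred[n] W)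

irregularising⇒distinct : ∀ {n} W → Irregularising (P n) W → DistinctTwoApart n (traversals (map toℕ W))
irregularising⇒distinct {n} W@(x ∷ xs) (iw , irregular) j 2+j<n same =
  irregular u v (fwd (trans (cong suc toℕu) (sym toℕv))) (begin
    degPlus (P n) W u                           ≡⟨ degPlus-P n W u ⟩
    degree n V (toℕ u)                          ≡⟨ cong (degree n V) toℕu ⟩
    degree n V (suc j)                          ≡⟨ degree-inner w j 1+j<n ⟩
    2 + (traversals V (suc j) + traversals V j) ≡⟨ cong (λ t → 2 + (traversals V (suc j) + t)) same ⟩
    2 + (traversals V (suc j) + traversals V (2 + j)) ≡⟨ cong (2 +_) (+-comm (traversals V (suc j)) _) ⟩
    2 + (traversals V (2 + j) + traversals V (suc j)) ≡⟨ degree-inner w (suc j) 2+j<n ⟨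
    degree n V (2 + j)                          ≡⟨ cong (degree n V) toℕv ⟨
    degree n V (toℕ v)                          ≡⟨ degPlus-P n W v ⟨
    degPlus (P n) W v                           ∎)
  where
  open ≡-Reasoning
  V : List ℕ
  V = map toℕ W
  w : Walk (toℕ x) _ V
  w = proj₂ (isWalk⇒walk iw)
  1+j<n : suc j < n
  1+j<n = <-trans (n<1+n _) 2+j<n
  u v : Fin (suc n)
  u = fromℕ< (s≤s (<⇒≤ 1+j<n))
  v = fromℕ< (s≤s (<⇒≤ 2+j<n))
  toℕu : toℕ u ≡ suc j
  toℕu = toℕ-fromℕ< (s≤s (<⇒≤ 1+j<n))
  toℕv : toℕ v ≡ 2 + j
  toℕv = toℕ-fromℕ< (s≤s (<⇒≤ 2+j<n))

distinct⇒irregularising : ∀ {n a c} W → 2 ≤ n → Walk a c (map toℕ W) →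
  DistinctTwoApart n (traversals (map toℕ W)) → Irregularising (P n) W
distinct⇒irregularising {n} W 2≤n w distinct = walk⇒isWalk W w , irregular
  where
  V : List ℕ
  V = map toℕ W
  irregular : ∀ u v → PathAdj u v → degPlus (P n) W u ≢ degPlus (P n) W v
  irregular u v (fwd p) eq =
    consecutive-degrees-≢ w 2≤n (All-toℕ≤ W) distinct (toℕ u) (subst (_≤ n) (sym p) (toℕ≤pred[n] v))
      (trans (sym (degPlus-P n W u)) (trans eq (trans (degPlus-P n W v) (cong (degree n V) (sym p)))))
  irregular u v (bwd p) eq =
    consecutive-degrees-≢ w 2≤n (All-toℕ≤ W) distinct (toℕ v) (subst (_≤ n) (sym p) (toℕ≤pred[n] u))
      (trans (sym (degPlus-P n W v)) (trans (sym eq) (trans (degPlus-P n W u) (cong (degree n V) (sym p)))))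

irregularising⇒n*2≤10+length : ∀ {n} W → Irregularising (P n) W → n * 2 ≤ 10 + walkLength W
irregularising⇒n*2≤10+length {n} W@(x ∷ _) irregular@(iw , _) with y , w ← isWalk⇒walk iw = begin
  n * 2
    ≤⟨ walk-sum-bound w (irregularising⇒distinct W irregular) (toℕ≤pred[n] x) (toℕ≤pred[n] y) ⟩
  10 + sum (applyUpTo (traversals (map toℕ W)) n)
    ≤⟨ +-monoʳ-≤ 10 (sum-traversals≤walkLength n (map toℕ W)) ⟩
  10 + walkLength (map toℕ W)
    ≡⟨ cong (10 +_) (walkLength-map toℕ W) ⟩
  10 + walkLength W
    ∎
  where open ≤-Reasoning

irregularising⇒length≥ : ∀ {n m} → (∀ f → DistinctTwoApart n f → m ≤ sum (applyUpTo f n)) →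
  ∀ W → Irregularising (P n) W → m ≤ walkLength W
irregularising⇒length≥ {n} bound W irregular =
  ≤-trans (bound _ (irregularising⇒distinct W irregular))
    (≤-trans (sum-traversals≤walkLength n (map toℕ W)) (≤-reflexive (walkLength-map toℕ W)))

IrregularisingWalkOfLength : ℕ → ℕ → Set
IrregularisingWalkOfLength n m = Σ (List (Fin (suc n))) λ W → Irregularising (P n) W × walkLength W ≡ m

irregularisingWalk : ∀ {n a c V} → 2 ≤ n → Walk a c V → All (_≤ n) V →
  DistinctTwoApart n (traversals V) → IrregularisingWalkOfLength n (walkLength V)
irregularisingWalk {n} {V = V} 2≤n w V≤n distinct =
    W
  , distinct⇒irregularising W 2≤n (subst (Walk _ _) (sym W≡V) w)
      (subst (DistinctTwoApart n ∘ traversals) (sym W≡V) distinct)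
  , trans (sym (walkLength-map toℕ W)) (cong walkLength W≡V)
  where
  W : List (Fin (suc n))
  W = toFin V V≤n
  W≡V : map toℕ W ≡ V
  W≡V = map-toℕ-toFin V V≤n

-- Irregularising walks of length 2n − 10

-- Every segment below starts 0, 1, 2, so `distinct` checks all counts of p ▹ vs up to edge s + 1.
record Prefix (s : ℕ) : Set where
  field
    vertices : List ℕ
    {start}  : ℕ
    walk     : Walk start s (vertices ∷ʳ s)
    bounded  : True (All.all? (_≤? s) vertices)
    distinct : True (distinctTwoApart? (2 + s) (traversals (vertices ++ map (_+ s) (0 ∷ 1 ∷ 2 ∷ []))))

infixr 5 _▹_

_▹_ : ∀ {s} → Prefix s → List ℕ → List ℕ
_▹_ {s} p vs = Prefix.vertices p ++ map (_+ s) (0 ∷ vs)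

module _ {s} (p : Prefix s) where
  open Prefix p

  prefix-walk : ∀ {c vs} → Walk 0 c (0 ∷ vs) → Walk start (c + s) (p ▹ vs)
  prefix-walk w = walk-++ vertices walk (walk-shift s w)

  prefix-bounded : ∀ {b vs} → All (_≤ b) (0 ∷ vs) → All (_≤ s + b) (p ▹ vs)
  prefix-bounded {b} vs≤b = All.++⁺ (All.map (λ x≤s → ≤-trans x≤s (m≤m+n s b)) (toWitness bounded))
    (All.map⁺ (All.map (λ {x} x≤b → subst (x + s ≤_) (+-comm b s) (+-monoˡ-≤ s x≤b)) vs≤b))

  prefix-length : ∀ vs → walkLength (p ▹ vs) ≡ length vertices + walkLength (0 ∷ vs)
  prefix-length vs = trans (walkLength-++ vertices s (map (_+ s) vs))
                           (cong (length vertices +_) (walkLength-map (_+ s) (0 ∷ vs)))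

  prefix-low : ∀ vs j → j < s → traversals (p ▹ vs) j ≡ traversals (vertices ∷ʳ s) j
  prefix-low vs j j<s = trans (traversals-++ vertices s (map (_+ s) vs) j)
    (trans (cong (traversals (vertices ∷ʳ s) j +_) beyond) (+-identityʳ _))
    where
    beyond : traversals (map (_+ s) (0 ∷ vs)) j ≡ 0
    beyond = traversals-below (map (_+ s) (0 ∷ vs)) ≤-refl
      (All.map⁺ (All.universal (λ x → <-≤-trans j<s (m≤n+m s x)) (0 ∷ vs)))

  prefix-high : ∀ vs i → traversals (p ▹ vs) (s + i) ≡ traversals (0 ∷ vs) i
  prefix-high vs i = begin
    traversals (p ▹ vs) (s + i)
      ≡⟨ traversals-++ vertices s (map (_+ s) vs) (s + i) ⟩
    traversals (vertices ∷ʳ s) (s + i) + traversals (map (_+ s) (0 ∷ vs)) (s + i)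
      ≡⟨ cong₂ _+_ (traversals-above (m≤m+n s i) walk (All.++⁺ (toWitness bounded) (≤-refl ∷ [])))
                   (cong (traversals (map (_+ s) (0 ∷ vs))) (+-comm s i)) ⟩
    traversals (map (_+ s) (0 ∷ vs)) (i + s)
      ≡⟨ traversals-shift s (0 ∷ vs) i ⟩
    traversals (0 ∷ vs) i
      ∎
    where open ≡-Reasoning

  prefix-agree : ∀ {m} vs us → (∀ i → i < m → traversals (0 ∷ vs) i ≡ traversals (0 ∷ us) i) →
    ∀ j → j < s + m → traversals (p ▹ vs) j ≡ traversals (p ▹ us) j
  prefix-agree vs us agree j j<s+m with j <? s
  ... | yes j<s = trans (prefix-low vs j j<s) (sym (prefix-low us j j<s))
  ... | no j≮s with i , refl ← m≤n⇒∃[o]m+o≡n (≮⇒≥ j≮s) =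
    trans (prefix-high vs i) (trans (agree i (+-cancelˡ-< s _ _ j<s+m)) (sym (prefix-high us i)))

  prefix-distinct : ∀ {m} vs → traversals (0 ∷ vs) 0 ≡ 1 → traversals (0 ∷ vs) 1 ≡ 1 →
    DistinctTwoApart m (traversals (0 ∷ vs)) → DistinctTwoApart (s + m) (traversals (p ▹ vs))
  prefix-distinct vs once₀ once₁ vs-distinct = distinctTwoApart-glue s near-prefix (prefix-high vs) vs-distinct
    where
    agree : ∀ j → j < 2 + s → traversals (p ▹ (1 ∷ 2 ∷ [])) j ≡ traversals (p ▹ vs) j
    agree j lt = prefix-agree (1 ∷ 2 ∷ []) vs
      (λ { 0 _ → sym once₀ ; 1 _ → sym once₁ ; (suc (suc _)) (s≤s (s≤s ())) }) j (subst (j <_) (+-comm 2 s) lt)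
    near-prefix : DistinctTwoApart (2 + s) (traversals (p ▹ vs))
    near-prefix j lt e =
      toWitness distinct j lt (trans (agree j (≤-<-trans (m≤n+m j 2) lt)) (trans e (sym (agree (2 + j) lt))))

-- `distinct` also covers the edges b and b + 1, which the walk never crosses.
record Segment (b ℓ : ℕ) : Set where
  field
    tail     : List ℕ
    {end}    : ℕ
    walk     : Walk 0 end (0 ∷ tail)
    bounded  : All (_≤ b) (0 ∷ tail)
    length≡  : walkLength (0 ∷ tail) ≡ ℓ
    once₀    : traversals (0 ∷ tail) 0 ≡ 1
    once₁    : traversals (0 ∷ tail) 1 ≡ 1
    distinct : DistinctTwoApart (2 + b) (traversals (0 ∷ tail))

block : Prefix 4
block = record
  { vertices = 0 ∷ 1 ∷ 2 ∷ 3 ∷ 4 ∷ 3 ∷ 2 ∷ 3 ∷ []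
  ; walk     = up refl ∷ up refl ∷ up refl ∷ up refl ∷ down refl ∷ down refl ∷ up refl ∷ up refl ∷ [-]
  }

extend : ∀ {b ℓ} → Segment b ℓ → Segment (4 + b) (8 + ℓ)
extend S = record
  { tail     = 1 ∷ 2 ∷ 3 ∷ 4 ∷ 3 ∷ 2 ∷ 3 ∷ map (_+ 4) (0 ∷ tail)
  ; walk     = prefix-walk block walk
  ; bounded  = prefix-bounded block bounded
  ; length≡  = trans (prefix-length block tail) (cong (8 +_) length≡)
  ; once₀    = prefix-low block tail 0 (s≤s z≤n)
  ; once₁    = prefix-low block tail 1 (s≤s (s≤s z≤n))
  ; distinct = prefix-distinct block tail once₀ once₁ distinct
  }
  where open Segment S

blocks : ∀ {b ℓ} → Segment b ℓ → ∀ k → Segment (k * 4 + b) (k * 8 + ℓ)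
blocks S zero    = S
blocks S (suc k) = extend (blocks S k)

decidedSegment : ∀ {b end} tail → Walk 0 end (0 ∷ tail) →
  {True (All.all? (_≤? b) (0 ∷ tail))} →
  {True (traversals (0 ∷ tail) 0 ≟ 1)} → {True (traversals (0 ∷ tail) 1 ≟ 1)} →
  {True (distinctTwoApart? (2 + b) (traversals (0 ∷ tail)))} →
  Segment b (walkLength (0 ∷ tail))
decidedSegment tail w {bounded} {once₀} {once₁} {distinct} = record
  { tail     = tail
  ; walk     = w
  ; bounded  = toWitness bounded
  ; length≡  = refl
  ; once₀    = toWitness once₀
  ; once₁    = toWitness once₁
  ; distinct = toWitness distinct
  }

segment₀ : Segment 2 2
segment₀ = decidedSegment (1 ∷ 2 ∷ []) (up refl ∷ up refl ∷ [-])

segment₁ : Segment 3 4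
segment₁ = decidedSegment (1 ∷ 2 ∷ 3 ∷ 2 ∷ []) (up refl ∷ up refl ∷ up refl ∷ down refl ∷ [-])

segment₂ : Segment 4 6
segment₂ = decidedSegment (1 ∷ 2 ∷ 3 ∷ 4 ∷ 3 ∷ 2 ∷ [])
  (up refl ∷ up refl ∷ up refl ∷ up refl ∷ down refl ∷ down refl ∷ [-])

pad₀₀ : Prefix 2
pad₀₀ = record { vertices = [] ; walk = [-] }

pad₀₀₂₂ : Prefix 4
pad₀₀₂₂ = record
  { vertices = 4 ∷ 3 ∷ 2 ∷ 3 ∷ [] ; walk = down refl ∷ down refl ∷ up refl ∷ up refl ∷ [-] }

segment-irregularising : ∀ {s b ℓ n m} (p : Prefix s) → Segment b ℓ →
  n ≡ s + (2 + b) → m ≡ length (Prefix.vertices p) + ℓ → IrregularisingWalkOfLength n m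
segment-irregularising {s} {b} p S refl refl =
  let W , irregular , W≡ = irregularisingWalk 2≤n (prefix-walk p walk) bound
                             (prefix-distinct p tail once₀ once₁ distinct)
  in  W , irregular , trans W≡ (trans (prefix-length p tail) (cong (length (Prefix.vertices p) +_) length≡))
  where
  open Segment S
  2≤n : 2 ≤ s + (2 + b)
  2≤n = ≤-trans (m≤m+n 2 b) (m≤n+m (2 + b) s)
  bound : All (_≤ s + (2 + b)) (p ▹ tail)
  bound = All.map (λ x≤ → ≤-trans x≤ (+-monoʳ-≤ s (m≤n+m b 2))) (prefix-bounded p bounded)

irregularisingWalk-by-residue : ∀ r k → r < 4 →
  IrregularisingWalkOfLength (6 + (r + k * 4)) (2 + 2 * (r + k * 4))
irregularisingWalk-by-residue 0 k _ = segment-irregularising pad₀₀   (blocks segment₀ k) (size₀ k) (length₀ k)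
  where
  size₀ : ∀ k → 6 + (0 + k * 4) ≡ 2 + (2 + (k * 4 + 2))
  size₀ = solve-∀
  length₀ : ∀ k → 2 + 2 * (0 + k * 4) ≡ 0 + (k * 8 + 2)
  length₀ = solve-∀
irregularisingWalk-by-residue 1 k _ = segment-irregularising pad₀₀   (blocks segment₁ k) (size₁ k) (length₁ k)
  where
  size₁ : ∀ k → 6 + (1 + k * 4) ≡ 2 + (2 + (k * 4 + 3))
  size₁ = solve-∀
  length₁ : ∀ k → 2 + 2 * (1 + k * 4) ≡ 0 + (k * 8 + 4)
  length₁ = solve-∀
irregularisingWalk-by-residue 2 k _ = segment-irregularising pad₀₀   (blocks segment₂ k) (size₂ k) (length₂ k)
  where
  size₂ : ∀ k → 6 + (2 + k * 4) ≡ 2 + (2 + (k * 4 + 4))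
  size₂ = solve-∀
  length₂ : ∀ k → 2 + 2 * (2 + k * 4) ≡ 0 + (k * 8 + 6)
  length₂ = solve-∀
irregularisingWalk-by-residue 3 k _ = segment-irregularising pad₀₀₂₂ (blocks segment₁ k) (size₃ k) (length₃ k)
  where
  size₃ : ∀ k → 6 + (3 + k * 4) ≡ 4 + (2 + (k * 4 + 3))
  size₃ = solve-∀
  length₃ : ∀ k → 2 + 2 * (3 + k * 4) ≡ 4 + (k * 8 + 4)
  length₃ = solve-∀
irregularisingWalk-by-residue (suc (suc (suc (suc _)))) _ (s≤s (s≤s (s≤s (s≤s ()))))

2*[6+m]∸10 : ∀ m → 2 * (6 + m) ∸ 10 ≡ 2 + 2 * m
2*[6+m]∸10 m = trans (cong (_∸ 10) (double m)) (m+n∸m≡n 10 (2 + 2 * m))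
  where
  double : ∀ m → 2 * (6 + m) ≡ 10 + (2 + 2 * m)
  double = solve-∀

irregularisingWalk-≥6 : ∀ n → 6 ≤ n → IrregularisingWalkOfLength n (2 * n ∸ 10)
irregularisingWalk-≥6 n 6≤n with m , refl ← m≤n⇒∃[o]m+o≡n 6≤n =
  subst (IrregularisingWalkOfLength (6 + m)) (sym (2*[6+m]∸10 m))
    (subst (λ x → IrregularisingWalkOfLength (6 + x) (2 + 2 * x)) (sym (m≡m%n+[m/n]*n m 4))
      (irregularisingWalk-by-residue (m % 4) (m / 4) (m%n<n m 4)))

decidedWalk : ∀ {n a c V} → 2 ≤ n → Walk a c V →
  {True (All.all? (_≤? n) V)} → {True (distinctTwoApart? n (traversals V))} →
  IrregularisingWalkOfLength n (walkLength V)
decidedWalk 2≤n w {bounded} {distinct} = irregularisingWalk 2≤n w (toWitness bounded) (toWitness distinct)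

theorem5p5 : MLW≡ (P 2) 0 × MLW≡ (P 3) 1 × MLW≡ (P 4) 2 × MLW≡ (P 5) 2
    × (∀ n → 6 ≤ n → MLW≡ (P n) (2 * n ∸ 10))
theorem5p5 =
    (decidedWalk {V = 0 ∷ []}         2≤2+ [-]                       , λ _ _ → z≤n)
  , (decidedWalk {V = 0 ∷ 1 ∷ []}     2≤2+ (up refl ∷ [-])           , irregularising⇒length≥ (distinctTwoApart⇒1≤sum 0))
  , (decidedWalk {V = 0 ∷ 1 ∷ 2 ∷ []} 2≤2+ (up refl ∷ up refl ∷ [-]) , irregularising⇒length≥ (distinctTwoApart⇒2≤sum 0))
  , (decidedWalk {V = 1 ∷ 2 ∷ 3 ∷ []} 2≤2+ (up refl ∷ up refl ∷ [-]) , irregularising⇒length≥ (distinctTwoApart⇒2≤sum 1))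
  , λ n 6≤n → irregularisingWalk-≥6 n 6≤n , λ W irregular →
      m≤n+o⇒m∸n≤o (2 * n) 10 (subst (_≤ 10 + walkLength W) (*-comm n 2) (irregularising⇒n*2≤10+length W irregular))
  where
  2≤2+ : ∀ {k} → 2 ≤ 2 + k
  2≤2+ = s≤s (s≤s z≤n)
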